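{- Let $d \geq 2$ be an integer and let $n = d$ or $n = d+1$. Let $D = (d_{1}, \dots, d_{n}) \in \mathbf{R}^n$ with $d_{1} \geq \cdots \geq d_{n} \geq 0$ and $d\, d_{1} \leq \sum_{i=1}^{n} d_{i}$. Then there exists a unique weight function $w$ assigning a nonnegative real number to each $d$-element subset of $V = \{v_1,\dots,v_n\}$ such that the $d$-uniform weighted hypergraph $(V, E, w)$, with $E$ the set of all $d$-element subsets of $V$, has weighted degree sequence $D$.
   Context: For a $d$-uniform weighted hypergraph $(V,E,w)$ on $V=\{v_1,\dots,v_n\}$ (edges are $d$-element subsets of $V$, weights $w(e) \geq 0$), the weighted degree at $v_i$ is $d_i := \sum_{e \in E,\ v_i \in e} w(e)$, and $(d_1,\dots,d_n)$ is the weighted degree sequence. -}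

module Defs where

open import Data.Nat using (ℕ; zero; suc)
open import Data.Fin using (Fin)
open import Data.Fin.Subset using (Subset; inside; outside; ∣_∣; _∈_)
open import Data.Fin.Subset.Properties using (_∈?_)
open import Data.Vec using ([]; _∷_)
open import Data.List using (List; []; _∷_; map; _++_)
open import Data.Product using (Σ; ∃; _×_; _,_)
import Data.Sum
open import Relation.Binary.PropositionalEquality using (_≡_)
open import Relation.Nullary using (¬_; Dec; yes; no)
open import Data.Nat using () renaming (_≟_ to _≟ℕ_)

-- The real numbers, axiomatised as a Dedekind-complete ordered field
-- (the standard axioms characterising ℝ up to isomorphism).
record RealField : Set₁ where
  infixl 6 _+_
  infixl 7 _*_
  infix 4 _≤ᴿ_
  field
    Carrier : Set
    0# 1#   : Carrier
    _+_ _*_ : Carrier → Carrier → Carrier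
    -_      : Carrier → Carrier
    _⁻¹⟨_⟩  : (x : Carrier) → ¬ (x ≡ 0#) → Carrier
    _≤ᴿ_     : Carrier → Carrier → Set
    +-assoc : ∀ x y z → (x + y) + z ≡ x + (y + z)
    +-comm  : ∀ x y → x + y ≡ y + x
    +-identityˡ : ∀ x → 0# + x ≡ x
    -‿inverseˡ : ∀ x → (- x) + x ≡ 0#
    *-assoc : ∀ x y z → (x * y) * z ≡ x * (y * z)
    *-comm  : ∀ x y → x * y ≡ y * x
    *-identityˡ : ∀ x → 1# * x ≡ x
    ⁻¹-inverseˡ : ∀ x (x≢0 : ¬ (x ≡ 0#)) → (x ⁻¹⟨ x≢0 ⟩) * x ≡ 1#
    distribˡ : ∀ x y z → x * (y + z) ≡ (x * y) + (x * z)
    0≢1 : ¬ (0# ≡ 1#)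
    ≤-refl : ∀ x → x ≤ᴿ x
    ≤-antisym : ∀ {x y} → x ≤ᴿ y → y ≤ᴿ x → x ≡ y
    ≤-trans : ∀ {x y z} → x ≤ᴿ y → y ≤ᴿ z → x ≤ᴿ z
    ≤-total : ∀ x y → (x ≤ᴿ y) Data.Sum.⊎ (y ≤ᴿ x)
    +-monoʳ-≤ : ∀ {x y} z → x ≤ᴿ y → x + z ≤ᴿ y + z
    *-nonneg : ∀ {x y} → 0# ≤ᴿ x → 0# ≤ᴿ y → 0# ≤ᴿ x * y
    sup : (P : Carrier → Set) → (∃ λ x → P x) → (∃ λ b → ∀ x → P x → x ≤ᴿ b) →
          ∃ λ s → (∀ x → P x → x ≤ᴿ s) × (∀ b → (∀ x → P x → x ≤ᴿ b) → s ≤ᴿ b)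

  embℕ : ℕ → Carrier
  embℕ zero = 0#
  embℕ (suc k) = 1# + embℕ k

  ΣFin : (n : ℕ) → (Fin n → Carrier) → Carrier
  ΣFin zero f = 0#
  ΣFin (suc n) f = f Fin.zero + ΣFin n (λ i → f (Fin.suc i))

  ΣList : {A : Set} → List A → (A → Carrier) → Carrier
  ΣList [] f = 0#
  ΣList (x ∷ xs) f = f x + ΣList xs f

open import Data.Sum using (_⊎_)

allSubsets : (n : ℕ) → List (Subset n)
allSubsets zero = [] ∷ []
allSubsets (suc n) = map (inside ∷_) (allSubsets n) ++ map (outside ∷_) (allSubsets n)

module _ (R : RealField) where
  open RealField R

  -- weighted degree of vertex i in the d-uniform hypergraph on Fin n whose
  -- edge set is all d-element subsets, with weight w (only the values of w
  -- on d-element subsets matter)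
  weightedDegree : (n d : ℕ) → (Subset n → Carrier) → Fin n → Carrier
  weightedDegree n d w i = ΣList (allSubsets n) term
    where
      term : Subset n → Carrier
      term s with ∣ s ∣ ≟ℕ d | i ∈? s
      ... | yes _ | yes _ = w s
      ... | _     | _     = 0#

-- For n = d the only edge is the whole vertex set, so every degree equals its weight;
-- the hypothesis d·d₁ ≤ Σ dᵢ together with dᵢ ≤ d₁ forces all degrees to be equal.
-- For n = d + 1 the edges are the complements V ∖ {vⱼ}, and vertex i lies in all of them
-- but its own, so dᵢ = W − w(V ∖ {vᵢ}) with W the total weight. Summing over i gives
-- Σ dᵢ = d·W, hence the weights are forced to be w(V ∖ {vᵢ}) = (Σ dⱼ)/d − dᵢ, and these
-- are nonnegative exactly because dᵢ ≤ d₁ ≤ (Σ dⱼ)/d.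
module Submission where

open import Defs
open import Data.Nat using (ℕ; suc; _≤_)
open import Data.Fin using (Fin; zero; fromℕ; toℕ)
open import Data.Fin.Subset using (Subset; ∣_∣)
open import Data.Product using (Σ; ∃; _×_)
open import Data.Sum using (_⊎_)
open import Relation.Binary.PropositionalEquality using (_≡_)

open import Algebra.Bundles using (CommutativeRing)
open import Algebra.Structures using (IsCommutativeRing)
open import Algebra.Consequences.Propositional using (comm∧idˡ⇒id; comm∧invˡ⇒inv; comm∧distrˡ⇒distrʳ)
import Algebra.Properties.AbelianGroup as AbelianGroupProperties
import Algebra.Properties.CommutativeSemigroup as CommutativeSemigroupProperties
import Algebra.Properties.Ring as RingProperties
open import Data.Empty using (⊥-elim)
open import Data.Fin using () renaming (suc to fsuc)
open import Data.Fin.Subset using (inside; outside; ⊤; ⊥; ⁅_⁆; ∁; _∈_; _∉_)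
open import Data.Fin.Properties using () renaming (suc-injective to fsuc-injective)
open import Data.Fin.Subset.Properties
  using ( _∈?_; ∈⊤; ∣⊤∣≡n; ∣p∣≡n⇒p≡⊤; ∣p∣≤n; ∣∁p∣≡n∸∣p∣; ∣⁅x⁆∣≡1
        ; x∈⁅x⁆; x≢y⇒x∉⁅y⁆; x∉p⇒x∈∁p; x∈p⇒x∉∁p)
open import Data.List using (List; []; _∷_; map; _++_)
open import Data.Nat using (z≤n; s≤s; _∸_) renaming (_≟_ to _≟ℕ_)
open import Data.Nat.Properties using (suc-injective; <⇒≢)
open import Data.Product using (_,_; proj₁; proj₂)
open import Data.Sum using (inj₁; inj₂)
open import Data.Vec using ([]; _∷_)
open import Function using (_∘_)
open import Relation.Binary.PropositionalEquality
  using (_≢_; refl; sym; trans; cong; cong₂; subst₂; isEquivalence; module ≡-Reasoning)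
open import Relation.Nullary using (yes; no)

∁⊥≡⊤ : ∀ n → ∁ (⊥ {n}) ≡ ⊤
∁⊥≡⊤ ℕ.zero = refl
∁⊥≡⊤ (suc n) = cong (inside ∷_) (∁⊥≡⊤ n)

∣∁⁅x⁆∣≡n : ∀ {n} (x : Fin (suc n)) → ∣ ∁ ⁅ x ⁆ ∣ ≡ n
∣∁⁅x⁆∣≡n {n} x = trans (∣∁p∣≡n∸∣p∣ ⁅ x ⁆) (cong (suc n ∸_) (∣⁅x⁆∣≡1 x))

x≢y⇒x∈∁⁅y⁆ : ∀ {n} {x y : Fin n} → x ≢ y → x ∈ ∁ ⁅ y ⁆
x≢y⇒x∈∁⁅y⁆ = x∉p⇒x∈∁p ∘ x≢y⇒x∉⁅y⁆

x∉∁⁅x⁆ : ∀ {n} (x : Fin n) → x ∉ ∁ ⁅ x ⁆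
x∉∁⁅x⁆ x = x∈p⇒x∉∁p (x∈⁅x⁆ x)

∣p∣≡n⇒p≡∁⁅x⁆ : ∀ {n} (p : Subset (suc n)) → ∣ p ∣ ≡ n → ∃ λ x → p ≡ ∁ ⁅ x ⁆
∣p∣≡n⇒p≡∁⁅x⁆ {n} (outside ∷ p) ∣p∣≡n =
  zero , cong (outside ∷_) (trans (∣p∣≡n⇒p≡⊤ ∣p∣≡n) (sym (∁⊥≡⊤ n)))
∣p∣≡n⇒p≡∁⁅x⁆ {suc n} (inside ∷ p) ∣p∣≡n with ∣p∣≡n⇒p≡∁⁅x⁆ p (suc-injective ∣p∣≡n)
... | x , p≡∁⁅x⁆ = fsuc x , cong (inside ∷_) p≡∁⁅x⁆

module _ (R : RealField) where
  open RealField R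

  isCommutativeRing : IsCommutativeRing _≡_ _+_ _*_ -_ 0# 1#
  isCommutativeRing = record
    { isRing = record
      { +-isAbelianGroup = record
        { isGroup = record
          { isMonoid = record
            { isSemigroup = record
              { isMagma = record { isEquivalence = isEquivalence ; ∙-cong = cong₂ _+_ }
              ; assoc = +-assoc
              }
            ; identity = comm∧idˡ⇒id +-comm +-identityˡ
            }
          ; inverse = comm∧invˡ⇒inv +-comm -‿inverseˡ
          ; ⁻¹-cong = cong -_
          }
        ; comm = +-comm
        }
      ; *-cong = cong₂ _*_
      ; *-assoc = *-assoc
      ; *-identity = comm∧idˡ⇒id *-comm *-identityˡ
      ; distrib = distribˡ , comm∧distrˡ⇒distrʳ *-comm distribˡ
      }
    ; *-comm = *-comm
    }

  commutativeRing : CommutativeRing _ _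
  commutativeRing = record { isCommutativeRing = isCommutativeRing }

  open CommutativeRing commutativeRing
    using (+-identityʳ; -‿inverseʳ; distribʳ; zeroˡ; ring; +-abelianGroup; +-commutativeSemigroup)
  open AbelianGroupProperties +-abelianGroup
    using (x≈z//y; xyx⁻¹≈y; ∙-cancelˡ; ∙-cancelʳ; ⁻¹-∙-comm; ⁻¹-involutive; ε⁻¹≈ε)
  open CommutativeSemigroupProperties +-commutativeSemigroup using (interchange)
  open RingProperties ring using (-1*x≈-x; -‿distribʳ-*)
  open ≡-Reasoning

  +-monoˡ-≤ : ∀ z {x y} → x ≤ᴿ y → z + x ≤ᴿ z + y
  +-monoˡ-≤ z {x} {y} x≤y = subst₂ _≤ᴿ_ (+-comm x z) (+-comm y z) (+-monoʳ-≤ z x≤y)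

  +-cancelˡ-≤ : ∀ z {x y} → z + x ≤ᴿ z + y → x ≤ᴿ y
  +-cancelˡ-≤ z {x} {y} le = subst₂ _≤ᴿ_ (xyx⁻¹≈y z x) (xyx⁻¹≈y z y) (+-monoʳ-≤ (- z) le)

  +-cancelʳ-≤ : ∀ z {x y} → x + z ≤ᴿ y + z → x ≤ᴿ y
  +-cancelʳ-≤ z {x} {y} le = +-cancelˡ-≤ z (subst₂ _≤ᴿ_ (+-comm x z) (+-comm y z) le)

  x≤y⇒0≤y-x : ∀ {x y} → x ≤ᴿ y → 0# ≤ᴿ y + - x
  x≤y⇒0≤y-x {x} x≤y = subst₂ _≤ᴿ_ (-‿inverseʳ x) refl (+-monoʳ-≤ (- x) x≤y)

  0≤y-x⇒x≤y : ∀ {x y} → 0# ≤ᴿ y + - x → x ≤ᴿ y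
  0≤y-x⇒x≤y {x} {y} le = +-cancelʳ-≤ (- x) (subst₂ _≤ᴿ_ (sym (-‿inverseʳ x)) refl le)

  +-mono-≤ : ∀ {a b c d} → a ≤ᴿ b → c ≤ᴿ d → a + c ≤ᴿ b + d
  +-mono-≤ {b = b} {c} a≤b c≤d = ≤-trans (+-monoʳ-≤ c a≤b) (+-monoˡ-≤ b c≤d)

  +-nonneg : ∀ {x y} → 0# ≤ᴿ x → 0# ≤ᴿ y → 0# ≤ᴿ x + y
  +-nonneg {x} 0≤x 0≤y = ≤-trans 0≤x (subst₂ _≤ᴿ_ (+-identityʳ x) refl (+-monoˡ-≤ x 0≤y))

  -- If 1 ≤ 0 then 0 ≤ -1, and then 0 ≤ (-1)·(-1) = 1.
  0≤1 : 0# ≤ᴿ 1#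
  0≤1 with ≤-total 0# 1#
  ... | inj₁ 0≤1 = 0≤1
  ... | inj₂ 1≤0 = subst₂ _≤ᴿ_ refl -1*-1≡1 (*-nonneg 0≤-1 0≤-1)
    where
    0≤-1 : 0# ≤ᴿ - 1#
    0≤-1 = subst₂ _≤ᴿ_ refl (+-identityˡ (- 1#)) (x≤y⇒0≤y-x 1≤0)
    -1*-1≡1 : - 1# * - 1# ≡ 1#
    -1*-1≡1 = trans (-1*x≈-x (- 1#)) (⁻¹-involutive 1#)

  0≤embℕ : ∀ k → 0# ≤ᴿ embℕ k
  0≤embℕ ℕ.zero = ≤-refl 0#
  0≤embℕ (suc k) = +-nonneg 0≤1 (0≤embℕ k)

  embℕ-suc≢0 : ∀ k → embℕ (suc k) ≢ 0#
  embℕ-suc≢0 k 1+k≡0 =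
    0≢1 (≤-antisym 0≤1 (subst₂ _≤ᴿ_ (+-identityʳ 1#) 1+k≡0 (+-monoˡ-≤ 1# (0≤embℕ k))))

  *-monoˡ-≤-nonneg : ∀ {x y z} → 0# ≤ᴿ x → y ≤ᴿ z → x * y ≤ᴿ x * z
  *-monoˡ-≤-nonneg {x} {y} {z} 0≤x y≤z =
    0≤y-x⇒x≤y (subst₂ _≤ᴿ_ refl x[z-y]≡xz-xy (*-nonneg 0≤x (x≤y⇒0≤y-x y≤z)))
    where
    x[z-y]≡xz-xy : x * (z + - y) ≡ x * z + - (x * y)
    x[z-y]≡xz-xy = trans (distribˡ x z (- y)) (cong (x * z +_) (sym (-‿distribʳ-* x y)))

  *-cancelˡ-≡ : ∀ x {y z} (x≢0 : x ≢ 0#) → x * y ≡ x * z → y ≡ z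
  *-cancelˡ-≡ x {y} {z} x≢0 xy≡xz = begin
    y                       ≡⟨ sym (*-identityˡ y) ⟩
    1# * y                  ≡⟨ cong (_* y) (sym (⁻¹-inverseˡ x x≢0)) ⟩
    (x ⁻¹⟨ x≢0 ⟩ * x) * y   ≡⟨ *-assoc _ x y ⟩
    x ⁻¹⟨ x≢0 ⟩ * (x * y)   ≡⟨ cong (x ⁻¹⟨ x≢0 ⟩ *_) xy≡xz ⟩
    x ⁻¹⟨ x≢0 ⟩ * (x * z)   ≡⟨ sym (*-assoc _ x z) ⟩
    (x ⁻¹⟨ x≢0 ⟩ * x) * z   ≡⟨ cong (_* z) (⁻¹-inverseˡ x x≢0) ⟩
    1# * z                  ≡⟨ *-identityˡ z ⟩
    z                       ∎

  *-cancelˡ-≤-pos : ∀ {x y z} → 0# ≤ᴿ x → x ≢ 0# → x * y ≤ᴿ x * z → y ≤ᴿ z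
  *-cancelˡ-≤-pos {x} {y} {z} 0≤x x≢0 xy≤xz with ≤-total y z
  ... | inj₁ y≤z = y≤z
  ... | inj₂ z≤y =
    subst₂ _≤ᴿ_ refl (*-cancelˡ-≡ x x≢0 (≤-antisym xy≤xz (*-monoˡ-≤-nonneg 0≤x z≤y))) (≤-refl y)

  +-mono-≤-tight : ∀ {a b c d} → a ≤ᴿ b → c ≤ᴿ d → b + d ≤ᴿ a + c → a ≡ b × c ≡ d
  +-mono-≤-tight {a} {b} {c} {d} a≤b c≤d b+d≤a+c = a≡b , c≡d
    where
    a≡b : a ≡ b
    a≡b = ≤-antisym a≤b (+-cancelʳ-≤ d (≤-trans b+d≤a+c (+-monoˡ-≤ a c≤d)))
    c≡d : c ≡ d
    c≡d = ≤-antisym c≤d (+-cancelˡ-≤ b (subst₂ _≤ᴿ_ refl (cong (_+ c) a≡b) b+d≤a+c))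

  ΣFin-cong : ∀ n {f g : Fin n → Carrier} → (∀ i → f i ≡ g i) → ΣFin n f ≡ ΣFin n g
  ΣFin-cong ℕ.zero f≗g = refl
  ΣFin-cong (suc n) f≗g = cong₂ _+_ (f≗g zero) (ΣFin-cong n (f≗g ∘ fsuc))

  ΣFin-+ : ∀ n (f g : Fin n → Carrier) → ΣFin n (λ i → f i + g i) ≡ ΣFin n f + ΣFin n g
  ΣFin-+ ℕ.zero f g = sym (+-identityˡ 0#)
  ΣFin-+ (suc n) f g = trans (cong (f zero + g zero +_) (ΣFin-+ n (f ∘ fsuc) (g ∘ fsuc)))
                             (interchange (f zero) (g zero) _ _)

  ΣFin-neg : ∀ n (f : Fin n → Carrier) → ΣFin n (λ i → - f i) ≡ - ΣFin n f
  ΣFin-neg ℕ.zero f = sym ε⁻¹≈ε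
  ΣFin-neg (suc n) f = trans (cong (- f zero +_) (ΣFin-neg n (f ∘ fsuc))) (⁻¹-∙-comm (f zero) _)

  embℕ-suc-* : ∀ k x → embℕ (suc k) * x ≡ x + embℕ k * x
  embℕ-suc-* k x = trans (distribʳ x 1# (embℕ k)) (cong (_+ embℕ k * x) (*-identityˡ x))

  ΣFin-const : ∀ n c → ΣFin n (λ _ → c) ≡ embℕ n * c
  ΣFin-const ℕ.zero c = sym (zeroˡ c)
  ΣFin-const (suc n) c = trans (cong (c +_) (ΣFin-const n c)) (sym (embℕ-suc-* n c))

  ΣFin-mono-≤ : ∀ n {f g : Fin n → Carrier} → (∀ i → f i ≤ᴿ g i) → ΣFin n f ≤ᴿ ΣFin n g
  ΣFin-mono-≤ ℕ.zero f≤g = ≤-refl 0#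
  ΣFin-mono-≤ (suc n) f≤g = +-mono-≤ (f≤g zero) (ΣFin-mono-≤ n (f≤g ∘ fsuc))

  ΣFin-mono-≤-tight : ∀ n {f g : Fin n → Carrier} → (∀ i → f i ≤ᴿ g i) → ΣFin n g ≤ᴿ ΣFin n f →
                      ∀ i → f i ≡ g i
  ΣFin-mono-≤-tight (suc n) f≤g Σg≤Σf i with +-mono-≤-tight (f≤g zero) (ΣFin-mono-≤ n (f≤g ∘ fsuc)) Σg≤Σf
  ΣFin-mono-≤-tight (suc n) f≤g Σg≤Σf zero     | f₀≡g₀ , _   = f₀≡g₀
  ΣFin-mono-≤-tight (suc n) f≤g Σg≤Σf (fsuc i) | _ , Σf≡Σg =
    ΣFin-mono-≤-tight n (f≤g ∘ fsuc) (subst₂ _≤ᴿ_ Σf≡Σg refl (≤-refl _)) i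

  ΣFin-punctured : ∀ n (f g : Fin n → Carrier) i → g i ≡ 0# → (∀ j → i ≢ j → g j ≡ f j) →
                   ΣFin n g + f i ≡ ΣFin n f
  ΣFin-punctured (suc n) f g zero gᵢ≡0 g≗f = begin
    (g zero + ΣFin n (g ∘ fsuc)) + f zero
      ≡⟨ cong₂ (λ a b → (a + b) + f zero) gᵢ≡0 (ΣFin-cong n (λ j → g≗f (fsuc j) λ ())) ⟩
    (0# + ΣFin n (f ∘ fsuc)) + f zero      ≡⟨ cong (_+ f zero) (+-identityˡ _) ⟩
    ΣFin n (f ∘ fsuc) + f zero             ≡⟨ +-comm _ (f zero) ⟩
    f zero + ΣFin n (f ∘ fsuc)             ∎
  ΣFin-punctured (suc n) f g (fsuc i) gᵢ≡0 g≗f = begin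
    (g zero + ΣFin n (g ∘ fsuc)) + f (fsuc i)  ≡⟨ +-assoc _ _ _ ⟩
    g zero + (ΣFin n (g ∘ fsuc) + f (fsuc i))
      ≡⟨ cong₂ _+_ (g≗f zero λ ()) (ΣFin-punctured n (f ∘ fsuc) (g ∘ fsuc) i gᵢ≡0 tail) ⟩
    f zero + ΣFin n (f ∘ fsuc)                 ∎
    where
    tail : ∀ j → i ≢ j → g (fsuc j) ≡ f (fsuc j)
    tail j i≢j = g≗f (fsuc j) (i≢j ∘ fsuc-injective)

  ΣList-cong : ∀ {A : Set} (xs : List A) {f g : A → Carrier} → (∀ x → f x ≡ g x) → ΣList xs f ≡ ΣList xs g
  ΣList-cong [] f≗g = refl
  ΣList-cong (x ∷ xs) f≗g = cong₂ _+_ (f≗g x) (ΣList-cong xs f≗g)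

  ΣList-0 : ∀ {A : Set} (xs : List A) {f : A → Carrier} → (∀ x → f x ≡ 0#) → ΣList xs f ≡ 0#
  ΣList-0 [] f≗0 = refl
  ΣList-0 (x ∷ xs) f≗0 = trans (cong₂ _+_ (f≗0 x) (ΣList-0 xs f≗0)) (+-identityˡ 0#)

  ΣList-++ : ∀ {A : Set} (xs ys : List A) (f : A → Carrier) → ΣList (xs ++ ys) f ≡ ΣList xs f + ΣList ys f
  ΣList-++ [] ys f = sym (+-identityˡ _)
  ΣList-++ (x ∷ xs) ys f = trans (cong (f x +_) (ΣList-++ xs ys f)) (sym (+-assoc _ _ _))

  ΣList-map : ∀ {A B : Set} (g : A → B) (xs : List A) (f : B → Carrier) → ΣList (map g xs) f ≡ ΣList xs (f ∘ g)
  ΣList-map g [] f = refl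
  ΣList-map g (x ∷ xs) f = cong (f (g x) +_) (ΣList-map g xs f)

  ΣList-allSubsets-suc : ∀ n (f : Subset (suc n) → Carrier) →
    ΣList (allSubsets (suc n)) f ≡ ΣList (allSubsets n) (f ∘ (inside ∷_)) + ΣList (allSubsets n) (f ∘ (outside ∷_))
  ΣList-allSubsets-suc n f = trans (ΣList-++ (map (inside ∷_) (allSubsets n)) _ f)
    (cong₂ _+_ (ΣList-map (inside ∷_) (allSubsets n) f) (ΣList-map (outside ∷_) (allSubsets n) f))

  ΣList-allSubsets-⊤ : ∀ n (f : Subset n → Carrier) → (∀ s → ∣ s ∣ ≢ n → f s ≡ 0#) →
                       ΣList (allSubsets n) f ≡ f ⊤
  ΣList-allSubsets-⊤ ℕ.zero f _ = +-identityʳ (f ⊤)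
  ΣList-allSubsets-⊤ (suc n) f f≗0 = begin
    ΣList (allSubsets (suc n)) f  ≡⟨ ΣList-allSubsets-suc n f ⟩
    _                             ≡⟨ cong₂ _+_ (ΣList-allSubsets-⊤ n (f ∘ (inside ∷_)) inside≗0)
                                                (ΣList-0 (allSubsets n) outside≗0) ⟩
    f ⊤ + 0#                      ≡⟨ +-identityʳ (f ⊤) ⟩
    f ⊤                           ∎
    where
    inside≗0 : ∀ s → ∣ s ∣ ≢ n → f (inside ∷ s) ≡ 0#
    inside≗0 s ∣s∣≢n = f≗0 (inside ∷ s) (∣s∣≢n ∘ suc-injective)
    outside≗0 : ∀ s → f (outside ∷ s) ≡ 0#
    outside≗0 s = f≗0 (outside ∷ s) (<⇒≢ (s≤s (∣p∣≤n s)))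

  ΣList-allSubsets-∁⁅⁆ : ∀ n (f : Subset (suc n) → Carrier) → (∀ s → ∣ s ∣ ≢ n → f s ≡ 0#) →
                         ΣList (allSubsets (suc n)) f ≡ ΣFin (suc n) (λ j → f (∁ ⁅ j ⁆))
  ΣList-allSubsets-∁⁅⁆ n f f≗0 = begin
    ΣList (allSubsets (suc n)) f
      ≡⟨ ΣList-allSubsets-suc n f ⟩
    ΣList (allSubsets n) (f ∘ (inside ∷_)) + ΣList (allSubsets n) (f ∘ (outside ∷_))
      ≡⟨ cong₂ _+_ (insideSum n f f≗0) (ΣList-allSubsets-⊤ n (f ∘ (outside ∷_)) (f≗0 ∘ (outside ∷_))) ⟩
    ΣFin n (λ j → f (∁ ⁅ fsuc j ⁆)) + f (outside ∷ ⊤)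
      ≡⟨ +-comm _ _ ⟩
    f (outside ∷ ⊤) + ΣFin n (λ j → f (∁ ⁅ fsuc j ⁆))
      ≡⟨ cong₂ _+_ (cong (f ∘ (outside ∷_)) (sym (∁⊥≡⊤ n))) refl ⟩
    ΣFin (suc n) (λ j → f (∁ ⁅ j ⁆))  ∎
    where
    insideSum : ∀ k (g : Subset (suc k) → Carrier) → (∀ s → ∣ s ∣ ≢ k → g s ≡ 0#) →
                ΣList (allSubsets k) (g ∘ (inside ∷_)) ≡ ΣFin k (λ j → g (∁ ⁅ fsuc j ⁆))
    insideSum ℕ.zero g g≗0 = ΣList-0 (allSubsets 0) (λ (s : Subset 0) → g≗0 (inside ∷ s) λ ())
    insideSum (suc k) g g≗0 =
      ΣList-allSubsets-∁⁅⁆ k (g ∘ (inside ∷_)) (λ s ∣s∣≢k → g≗0 (inside ∷ s) (∣s∣≢k ∘ suc-injective))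

  incidentWeight : ∀ {n} → ℕ → (Subset n → Carrier) → Fin n → Subset n → Carrier
  incidentWeight d w i s with ∣ s ∣ ≟ℕ d | i ∈? s
  ... | yes _ | yes _ = w s
  ... | _     | _     = 0#

  -- The summand of weightedDegree is local to its where-block; this pair exposes it so that
  -- it can be compared pointwise with incidentWeight.
  weightedDegree-summand : ∀ n d w i →
    Σ (Subset n → Carrier) λ f → weightedDegree R n d w i ≡ ΣList (allSubsets n) f
  weightedDegree-summand n d w i = _ , refl

  weightedDegree≡ΣincidentWeight : ∀ n d w i → weightedDegree R n d w i ≡ ΣList (allSubsets n) (incidentWeight d w i)
  weightedDegree≡ΣincidentWeight n d w i =
    trans (proj₂ (weightedDegree-summand n d w i)) (ΣList-cong (allSubsets n) summand≗incidentWeight)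
    where
    summand≗incidentWeight : ∀ s → proj₁ (weightedDegree-summand n d w i) s ≡ incidentWeight d w i s
    summand≗incidentWeight s with ∣ s ∣ ≟ℕ d | i ∈? s
    ... | yes _ | yes _ = refl
    ... | yes _ | no _  = refl
    ... | no _  | _     = refl

  incidentWeight-∈ : ∀ {n d} w (i : Fin n) {s} → ∣ s ∣ ≡ d → i ∈ s → incidentWeight d w i s ≡ w s
  incidentWeight-∈ {d = d} w i {s} ∣s∣≡d i∈s with ∣ s ∣ ≟ℕ d | i ∈? s
  ... | yes _     | yes _ = refl
  ... | yes _     | no i∉s = ⊥-elim (i∉s i∈s)
  ... | no ∣s∣≢d | _     = ⊥-elim (∣s∣≢d ∣s∣≡d)

  incidentWeight-∉ : ∀ {n d} w (i : Fin n) {s} → i ∉ s → incidentWeight d w i s ≡ 0#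
  incidentWeight-∉ {d = d} w i {s} i∉s with ∣ s ∣ ≟ℕ d | i ∈? s
  ... | yes _ | yes i∈s = ⊥-elim (i∉s i∈s)
  ... | yes _ | no _    = refl
  ... | no _  | _       = refl

  incidentWeight-≢ : ∀ {n d} w (i : Fin n) s → ∣ s ∣ ≢ d → incidentWeight d w i s ≡ 0#
  incidentWeight-≢ {d = d} w i s ∣s∣≢d with ∣ s ∣ ≟ℕ d | i ∈? s
  ... | yes ∣s∣≡d | _ = ⊥-elim (∣s∣≢d ∣s∣≡d)
  ... | no _      | _ = refl

  weightedDegree-complete : ∀ n w (i : Fin n) → weightedDegree R n n w i ≡ w ⊤
  weightedDegree-complete n w i = begin
    weightedDegree R n n w i                     ≡⟨ weightedDegree≡ΣincidentWeight n n w i ⟩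
    ΣList (allSubsets n) (incidentWeight n w i)  ≡⟨ ΣList-allSubsets-⊤ n _ (incidentWeight-≢ w i) ⟩
    incidentWeight n w i ⊤                       ≡⟨ incidentWeight-∈ w i (∣⊤∣≡n n) ∈⊤ ⟩
    w ⊤                                          ∎

  weightedDegree-∁⁅⁆ : ∀ m w (i : Fin (suc m)) →
    weightedDegree R (suc m) m w i + w (∁ ⁅ i ⁆) ≡ ΣFin (suc m) (λ j → w (∁ ⁅ j ⁆))
  weightedDegree-∁⁅⁆ m w i = begin
    weightedDegree R (suc m) m w i + w (∁ ⁅ i ⁆)
      ≡⟨ cong (_+ w (∁ ⁅ i ⁆)) (weightedDegree≡ΣincidentWeight (suc m) m w i) ⟩
    ΣList (allSubsets (suc m)) (incidentWeight m w i) + w (∁ ⁅ i ⁆)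
      ≡⟨ cong (_+ w (∁ ⁅ i ⁆)) (ΣList-allSubsets-∁⁅⁆ m _ (incidentWeight-≢ w i)) ⟩
    ΣFin (suc m) (λ j → incidentWeight m w i (∁ ⁅ j ⁆)) + w (∁ ⁅ i ⁆)
      ≡⟨ ΣFin-punctured (suc m) (λ j → w (∁ ⁅ j ⁆)) _ i (incidentWeight-∉ w i (x∉∁⁅x⁆ i))
           (λ j i≢j → incidentWeight-∈ w i (∣∁⁅x⁆∣≡n j) (x≢y⇒x∈∁⁅y⁆ i≢j)) ⟩
    ΣFin (suc m) (λ j → w (∁ ⁅ j ⁆))  ∎

  NonNegativeOn : ℕ → ∀ {n} → (Subset n → Carrier) → Set
  NonNegativeOn d w = ∀ s → ∣ s ∣ ≡ d → 0# ≤ᴿ w s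

  HasDegrees : ∀ n d → (Subset n → Carrier) → (Fin n → Carrier) → Set
  HasDegrees n d w D = ∀ i → weightedDegree R n d w i ≡ D i

  UniquelyRealisable : ∀ n d → (Fin n → Carrier) → Set
  UniquelyRealisable n d D =
    Σ (Subset n → Carrier) (λ w → NonNegativeOn d w × HasDegrees n d w D)
    × (∀ w w′ → NonNegativeOn d w → HasDegrees n d w D → NonNegativeOn d w′ → HasDegrees n d w′ D →
       ∀ s → ∣ s ∣ ≡ d → w s ≡ w′ s)

  uniquelyRealisable : ∀ {n d D} w → NonNegativeOn d w → HasDegrees n d w D →
                       (∀ v → HasDegrees n d v D → ∀ s → ∣ s ∣ ≡ d → v s ≡ w s) →
                       UniquelyRealisable n d D
  uniquelyRealisable w w≥0 w-degrees agree =
    (w , w≥0 , w-degrees) ,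
    λ v v′ _ v-degrees _ v′-degrees s ∣s∣≡d →
      trans (agree v v-degrees s ∣s∣≡d) (sym (agree v′ v′-degrees s ∣s∣≡d))

  complete-uniquelyRealisable : ∀ n (D : Fin (suc n) → Carrier) →
    (∀ i → D i ≤ᴿ D zero) → 0# ≤ᴿ D zero → embℕ (suc n) * D zero ≤ᴿ ΣFin (suc n) D →
    UniquelyRealisable (suc n) (suc n) D
  complete-uniquelyRealisable n D D≤D₀ 0≤D₀ nD₀≤ΣD =
    uniquelyRealisable (λ _ → D zero) (λ _ _ → 0≤D₀) degrees agree
    where
    D≡D₀ : ∀ i → D i ≡ D zero
    D≡D₀ = ΣFin-mono-≤-tight (suc n) D≤D₀ (subst₂ _≤ᴿ_ (sym (ΣFin-const (suc n) (D zero))) refl nD₀≤ΣD)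
    degrees : HasDegrees (suc n) (suc n) (λ _ → D zero) D
    degrees i = trans (weightedDegree-complete (suc n) _ i) (sym (D≡D₀ i))
    agree : ∀ v → HasDegrees (suc n) (suc n) v D → ∀ s → ∣ s ∣ ≡ suc n → v s ≡ D zero
    agree v v-degrees s ∣s∣≡n = begin
      v s                                      ≡⟨ cong v (∣p∣≡n⇒p≡⊤ ∣s∣≡n) ⟩
      v ⊤                                      ≡⟨ sym (weightedDegree-complete (suc n) v zero) ⟩
      weightedDegree R (suc n) (suc n) v zero  ≡⟨ v-degrees zero ⟩
      D zero                                   ∎

  ΣOutside : ∀ {n} → (Fin n → Carrier) → Subset n → Carrier
  ΣOutside D []            = 0#
  ΣOutside D (inside ∷ s)  = ΣOutside (D ∘ fsuc) s
  ΣOutside D (outside ∷ s) = D zero + ΣOutside (D ∘ fsuc) s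

  ΣOutside-⊤ : ∀ n (D : Fin n → Carrier) → ΣOutside D ⊤ ≡ 0#
  ΣOutside-⊤ ℕ.zero D = refl
  ΣOutside-⊤ (suc n) D = ΣOutside-⊤ n (D ∘ fsuc)

  ΣOutside-∁⁅⁆ : ∀ {n} (D : Fin n → Carrier) j → ΣOutside D (∁ ⁅ j ⁆) ≡ D j
  ΣOutside-∁⁅⁆ {suc n} D zero = begin
    D zero + ΣOutside (D ∘ fsuc) (∁ ⊥)  ≡⟨ cong (λ p → D zero + ΣOutside (D ∘ fsuc) p) (∁⊥≡⊤ n) ⟩
    D zero + ΣOutside (D ∘ fsuc) ⊤      ≡⟨ cong (D zero +_) (ΣOutside-⊤ n (D ∘ fsuc)) ⟩
    D zero + 0#                          ≡⟨ +-identityʳ (D zero) ⟩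
    D zero                               ∎
  ΣOutside-∁⁅⁆ D (fsuc j) = ΣOutside-∁⁅⁆ (D ∘ fsuc) j

  module CoSingletons (d : ℕ) (d≢0 : embℕ d ≢ 0#) (D : Fin (suc d) → Carrier) where

    ΣD : Carrier
    ΣD = ΣFin (suc d) D

    -- The total weight Σ D / d that every realisation must have.
    W : Carrier
    W = embℕ d ⁻¹⟨ d≢0 ⟩ * ΣD

    d*W≡ΣD : embℕ d * W ≡ ΣD
    d*W≡ΣD = begin
      embℕ d * (embℕ d ⁻¹⟨ d≢0 ⟩ * ΣD)   ≡⟨ sym (*-assoc _ _ ΣD) ⟩
      (embℕ d * embℕ d ⁻¹⟨ d≢0 ⟩) * ΣD   ≡⟨ cong (_* ΣD) (trans (*-comm _ _) (⁻¹-inverseˡ _ d≢0)) ⟩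
      1# * ΣD                             ≡⟨ *-identityˡ ΣD ⟩
      ΣD                                  ∎

    Σ[W-D]≡W : ΣFin (suc d) (λ j → W + - D j) ≡ W
    Σ[W-D]≡W = begin
      ΣFin (suc d) (λ j → W + - D j)   ≡⟨ ΣFin-+ (suc d) (λ _ → W) (λ j → - D j) ⟩
      ΣFin (suc d) (λ _ → W) + ΣFin (suc d) (λ j → - D j)
                                       ≡⟨ cong₂ _+_ (ΣFin-const (suc d) W) (ΣFin-neg (suc d) D) ⟩
      embℕ (suc d) * W + - ΣD          ≡⟨ cong (_+ - ΣD) (trans (embℕ-suc-* d W) (cong (W +_) d*W≡ΣD)) ⟩
      W + ΣD + - ΣD                    ≡⟨ cong (_+ - ΣD) (+-comm W ΣD) ⟩
      ΣD + W + - ΣD                    ≡⟨ xyx⁻¹≈y ΣD W ⟩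
      W                                ∎

    degree+weight≡total : ∀ v → HasDegrees (suc d) d v D →
                          ∀ i → D i + v (∁ ⁅ i ⁆) ≡ ΣFin (suc d) (λ j → v (∁ ⁅ j ⁆))
    degree+weight≡total v v-degrees i =
      trans (cong (_+ v (∁ ⁅ i ⁆)) (sym (v-degrees i))) (weightedDegree-∁⁅⁆ d v i)

    degrees⇒weights : ∀ v → HasDegrees (suc d) d v D → ∀ j → v (∁ ⁅ j ⁆) ≡ W + - D j
    degrees⇒weights v v-degrees j = begin
      v (∁ ⁅ j ⁆)  ≡⟨ x≈z//y _ (D j) X (trans (+-comm _ (D j)) (degree+weight≡total v v-degrees j)) ⟩
      X + - D j    ≡⟨ cong (_+ - D j) X≡W ⟩
      W + - D j    ∎
      where
      X : Carrier
      X = ΣFin (suc d) (λ j → v (∁ ⁅ j ⁆))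
      ΣD+X≡X+d*X : ΣD + X ≡ X + embℕ d * X
      ΣD+X≡X+d*X = begin
        ΣD + X                                   ≡⟨ sym (ΣFin-+ (suc d) D (λ i → v (∁ ⁅ i ⁆))) ⟩
        ΣFin (suc d) (λ i → D i + v (∁ ⁅ i ⁆))   ≡⟨ ΣFin-cong (suc d) (degree+weight≡total v v-degrees) ⟩
        ΣFin (suc d) (λ _ → X)                   ≡⟨ ΣFin-const (suc d) X ⟩
        embℕ (suc d) * X                         ≡⟨ embℕ-suc-* d X ⟩
        X + embℕ d * X                           ∎
      ΣD≡d*X : ΣD ≡ embℕ d * X
      ΣD≡d*X = ∙-cancelˡ X _ _ (trans (+-comm X ΣD) ΣD+X≡X+d*X)
      X≡W : X ≡ W
      X≡W = *-cancelˡ-≡ (embℕ d) d≢0 (trans (sym ΣD≡d*X) (sym d*W≡ΣD))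

    weights⇒degrees : ∀ v → (∀ j → v (∁ ⁅ j ⁆) ≡ W + - D j) → HasDegrees (suc d) d v D
    weights⇒degrees v v≡W-D i = ∙-cancelʳ (W + - D i) _ _ (begin
      weightedDegree R (suc d) d v i + (W + - D i)   ≡⟨ cong (weightedDegree R (suc d) d v i +_) (sym (v≡W-D i)) ⟩
      weightedDegree R (suc d) d v i + v (∁ ⁅ i ⁆)   ≡⟨ weightedDegree-∁⁅⁆ d v i ⟩
      ΣFin (suc d) (λ j → v (∁ ⁅ j ⁆))               ≡⟨ ΣFin-cong (suc d) v≡W-D ⟩
      ΣFin (suc d) (λ j → W + - D j)                 ≡⟨ Σ[W-D]≡W ⟩
      W                                              ≡⟨ sym (xyx⁻¹≈y (D i) W) ⟩
      D i + W + - D i                                ≡⟨ +-assoc (D i) W (- D i) ⟩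
      D i + (W + - D i)                              ∎)

    -- Only the values W − D j on the edges ∁ ⁅ j ⁆ matter; ΣOutside extends them to all subsets.
    coSingletonWeight : Subset (suc d) → Carrier
    coSingletonWeight s = W + - ΣOutside D s

    coSingletonWeight-∁⁅⁆ : ∀ j → coSingletonWeight (∁ ⁅ j ⁆) ≡ W + - D j
    coSingletonWeight-∁⁅⁆ j = cong (λ x → W + - x) (ΣOutside-∁⁅⁆ D j)

    coSingleton-uniquelyRealisable : (∀ i → D i ≤ᴿ D zero) → embℕ d * D zero ≤ᴿ ΣD →
                                     UniquelyRealisable (suc d) d D
    coSingleton-uniquelyRealisable D≤D₀ dD₀≤ΣD =
      uniquelyRealisable coSingletonWeight nonNegative (weights⇒degrees coSingletonWeight coSingletonWeight-∁⁅⁆) agree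
      where
      D₀≤W : D zero ≤ᴿ W
      D₀≤W = *-cancelˡ-≤-pos (0≤embℕ d) d≢0 (subst₂ _≤ᴿ_ refl (sym d*W≡ΣD) dD₀≤ΣD)
      nonNegative : NonNegativeOn d coSingletonWeight
      nonNegative s ∣s∣≡d with ∣p∣≡n⇒p≡∁⁅x⁆ s ∣s∣≡d
      ... | j , refl =
        subst₂ _≤ᴿ_ refl (sym (coSingletonWeight-∁⁅⁆ j)) (x≤y⇒0≤y-x (≤-trans (D≤D₀ j) D₀≤W))
      agree : ∀ v → HasDegrees (suc d) d v D → ∀ s → ∣ s ∣ ≡ d → v s ≡ coSingletonWeight s
      agree v v-degrees s ∣s∣≡d with ∣p∣≡n⇒p≡∁⁅x⁆ s ∣s∣≡d
      ... | j , refl = trans (degrees⇒weights v v-degrees j) (sym (coSingletonWeight-∁⁅⁆ j))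

corollary4p5 : (R : RealField) → let open RealField R in
    (d m : ℕ) → 2 ≤ d → (suc m ≡ d ⊎ suc m ≡ suc d) →
    (D : Fin (suc m) → Carrier) →
    (∀ i j → toℕ i ≤ toℕ j → D j ≤ᴿ D i) →
    0# ≤ᴿ D (fromℕ m) →
    embℕ d * D zero ≤ᴿ ΣFin (suc m) D →
    Σ (Subset (suc m) → Carrier) (λ w →
        ((s : Subset (suc m)) → ∣ s ∣ ≡ d → 0# ≤ᴿ w s)
      × (∀ i → weightedDegree R (suc m) d w i ≡ D i))
    × (∀ (w w′ : Subset (suc m) → Carrier) →
        ((s : Subset (suc m)) → ∣ s ∣ ≡ d → 0# ≤ᴿ w s) →
        (∀ i → weightedDegree R (suc m) d w i ≡ D i) →
        ((s : Subset (suc m)) → ∣ s ∣ ≡ d → 0# ≤ᴿ w′ s) →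
        (∀ i → weightedDegree R (suc m) d w′ i ≡ D i) →
        (s : Subset (suc m)) → ∣ s ∣ ≡ d → w s ≡ w′ s)
corollary4p5 R d m _ (inj₁ refl) D antitone 0≤Dₘ dD₀≤ΣD =
  complete-uniquelyRealisable R m D (λ i → antitone zero i z≤n)
    (≤-trans 0≤Dₘ (antitone zero (fromℕ m) z≤n)) dD₀≤ΣD
  where open RealField R
corollary4p5 R (suc k) m (s≤s _) (inj₂ refl) D antitone _ dD₀≤ΣD =
  CoSingletons.coSingleton-uniquelyRealisable R (suc k) (embℕ-suc≢0 R k) D (λ i → antitone zero i z≤n) dD₀≤ΣD
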